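{- Let $F=(F_n)$ and $F'=(F'_n)$ be linear-like semiring families of graphs. Suppose there is $C\in\mathbb{N}$ and, for every $n\in\mathbb{N}$, a graph homomorphism $\phi_n:F_n\to F'_{Cn}$ such that for every $r\in\mathbb{N}$ and every $S\subseteq V(F_n)$ with $\mathrm{rk}(S)=r$ in $F_n$, we have $\mathrm{rk}(\phi_n(S))\ge Cr$ in $F'_{Cn}$. Then $\eta_{F',f}(G)\le\eta_{F,f}(G)$ for every finite graph $G$.
   Context: Graphs are undirected simple graphs, possibly infinite; $\omega$ is the clique number. The join $G+H$ is the disjoint union with all edges between the two parts added; the disjunctive product $G\ast H$ has vertex set $V(G)\times V(H)$ with $(v,w)\sim(v',w')$ iff $v\sim v'$ or $w\sim w'$. For $d\in\mathbb{N}_+$, $X/d$ is the graph of $d$-cliques of $X$, with $S\sim T$ iff $S\cap T=\emptyset$ and $s\sim t$ for all $s\in S,t\in T$. A semiring family is a sequence $(F_n)_{n\in\mathbb{N}}$ with $F_0=\emptyset$, $F_1\ne\emptyset$, and homomorphisms $F_n+F_m\to F_{n+m}$, $F_n\ast F_m\to F_{nm}$. For $S\subseteq V(X)$, $S^\perp$ is the set of vertices adjacent to all vertices of $S$; $S$ is a flat if $S^{\perp\perp}=S$; $\mathrm{rk}(S)=\omega(S^{\perp\perp})$. A family is linear-like if for every $n$ and every flat $S\subseteq V(F_n)$, the induced subgraph on $S$ is homomorphically equivalent to $F_{\mathrm{rk}(S)}$. For finite $G$, $\eta_{F,f}(G)=\inf\{n/d: n\in\mathbb{N},d\in\mathbb{N}_+,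 G\to F_n/d\}$, and similarly for $F'$. -}

module Defs where

open import Data.Nat using (ℕ; zero; suc; _+_; _*_; _≤_; _<_)
open import Data.Fin as Fin using (Fin)
open import Data.Product using (Σ; Σ-syntax; _×_; _,_; proj₁; proj₂)
open import Data.Sum using (_⊎_; inj₁; inj₂)
open import Data.Unit using (⊤)
open import Data.Empty using (⊥)
open import Relation.Nullary using (¬_)
open import Relation.Binary.PropositionalEquality using (_≡_; _≢_)
open import Function.Bundles using (_↔_)

record Graph : Set₁ where
  field
    V     : Set
    E     : V → V → Set
    sym   : ∀ {u v} → E u v → E v u
    irrefl : ∀ {v} → ¬ E v v
open Graph public

record Hom (G H : Graph) : Set where
  field
    map  : V G → V H
    pres : ∀ {u v} → E G u v → E H (map u) (map v)
open Hom public

HomEquiv : Graph → Graph → Set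
HomEquiv G H = Hom G H × Hom H G

Finite : Graph → Set
Finite G = Σ[ k ∈ ℕ ] (V G ↔ Fin k)

Subset : Graph → Set₁
Subset X = V X → Set

_⊆_ : {X : Graph} → Subset X → Subset X → Set
_⊆_ {X} S T = ∀ v → S v → T v

_⊥' : {X : Graph} → Subset X → Subset X
_⊥' {X} S v = ∀ s → S s → E X v s

Flat : (X : Graph) → Subset X → Set
Flat X S = (_⊆_ {X} (_⊥' {X} (_⊥' {X} S)) S) × (_⊆_ {X} S (_⊥' {X} (_⊥' {X} S)))

HasCliqueIn : (X : Graph) → Subset X → ℕ → Set
HasCliqueIn X P k =
  Σ[ f ∈ (Fin k → V X) ] ((∀ i → P (f i)) × (∀ i j → i ≢ j → E X (f i) (f j)))

Rank : (X : Graph) → Subset X → ℕ → Set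
Rank X S r = HasCliqueIn X S⊥⊥ r × ¬ HasCliqueIn X S⊥⊥ (suc r)
  where S⊥⊥ = _⊥' {X} (_⊥' {X} S)

RankAtLeast : (X : Graph) → Subset X → ℕ → Set
RankAtLeast X S k = HasCliqueIn X (_⊥' {X} (_⊥' {X} S)) k

Induced : (X : Graph) → Subset X → Graph
Induced X S = record
  { V = Σ (V X) S
  ; E = λ { (u , _) (v , _) → E X u v }
  ; sym = sym X
  ; irrefl = irrefl X }

Image : {X Y : Graph} → (V X → V Y) → Subset X → Subset Y
Image {X} f S w = Σ[ v ∈ V X ] (S v × f v ≡ w)

JE : (G H : Graph) → V G ⊎ V H → V G ⊎ V H → Set
JE G H (inj₁ u) (inj₁ v) = E G u v
JE G H (inj₁ u) (inj₂ v) = ⊤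
JE G H (inj₂ u) (inj₁ v) = ⊤
JE G H (inj₂ u) (inj₂ v) = E H u v

JE-sym : (G H : Graph) → ∀ {u v} → JE G H u v → JE G H v u
JE-sym G H {inj₁ u} {inj₁ v} e = sym G e
JE-sym G H {inj₁ u} {inj₂ v} e = e
JE-sym G H {inj₂ u} {inj₁ v} e = e
JE-sym G H {inj₂ u} {inj₂ v} e = sym H e

JE-irr : (G H : Graph) → ∀ {v} → ¬ JE G H v v
JE-irr G H {inj₁ v} = irrefl G
JE-irr G H {inj₂ v} = irrefl H

_⊕_ : Graph → Graph → Graph
G ⊕ H = record { V = V G ⊎ V H ; E = JE G H ; sym = λ {u} {v} → JE-sym G H {u} {v} ; irrefl = λ {v} → JE-irr G H {v} }

DE : (G H : Graph) → V G × V H → V G × V H → Set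
DE G H (v , w) (v' , w') = E G v v' ⊎ E H w w'

DE-sym : (G H : Graph) → ∀ {p q} → DE G H p q → DE G H q p
DE-sym G H (inj₁ e) = inj₁ (sym G e)
DE-sym G H (inj₂ e) = inj₂ (sym H e)

DE-irr : (G H : Graph) → ∀ {p} → ¬ DE G H p p
DE-irr G H (inj₁ e) = irrefl G e
DE-irr G H (inj₂ e) = irrefl H e

_⊛_ : Graph → Graph → Graph
G ⊛ H = record { V = V G × V H ; E = DE G H ; sym = DE-sym G H ; irrefl = DE-irr G H }

-- X / d for d ∈ ℕ₊ : graph of d-cliques of X. We write  X /suc k  for X/(suc k).
-- A d-clique is represented by an enumeration Fin d → V X of its pairwise
-- adjacent (hence distinct) vertices; S ~ T iff every s ∈ S is adjacent to
-- every t ∈ T (which by irreflexivity forces S ∩ T = ∅).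
IsClique : (X : Graph) (d : ℕ) → (Fin d → V X) → Set
IsClique X d f = ∀ i j → i ≢ j → E X (f i) (f j)

_/suc_ : Graph → ℕ → Graph
X /suc k = record
  { V = Σ (Fin (suc k) → V X) (IsClique X (suc k))
  ; E = λ p q → ∀ i j → E X (proj₁ p i) (proj₁ q j)
  ; sym = λ e i j → sym X (e j i)
  ; irrefl = λ e → irrefl X (e Fin.zero Fin.zero) }

record SemiringFamily : Set₁ where
  field
    F      : ℕ → Graph
    empty0 : ¬ V (F 0)
    inhab1 : V (F 1)
    addHom : ∀ n m → Hom (F n ⊕ F m) (F (n + m))
    mulHom : ∀ n m → Hom (F n ⊛ F m) (F (n * m))
open SemiringFamily public

LinearLike : SemiringFamily → Set₁
LinearLike 𝓕 = ∀ n (S : Subset (F 𝓕 n)) → Flat (F 𝓕 n) S →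
  Σ[ r ∈ ℕ ] (Rank (F 𝓕 n) S r × HomEquiv (Induced (F 𝓕 n) S) (F 𝓕 r))

-- G → F_n/d with d = suc k witnesses n/d ∈ the set whose infimum is η_{F,f}(G).
Achieves : SemiringFamily → Graph → ℕ → ℕ → Set
Achieves 𝓕 G n k = Hom G (F 𝓕 n /suc k)

-- η_{F',f}(G) ≤ η_{F,f}(G), unfolded (infimum over rationals, value +∞ if empty):
-- for every n/d achieved for F and every rational a/b > n/d (b ≥ 1),
-- some n'/d' ≤ a/b is achieved for F'. Fractions compared by cross-multiplication.
EtaLE : SemiringFamily → SemiringFamily → Graph → Set
EtaLE 𝓕' 𝓕 G = ∀ n k → Achieves 𝓕 G n k →
  ∀ a b → n * suc b < a * suc k →
  Σ[ n' ∈ ℕ ] Σ[ k' ∈ ℕ ] (Achieves 𝓕' G n' k' × n' * suc b ≤ a * suc k')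

-- A d-clique K of F_n spans a flat K⊥⊥ of rank at least d, so φ_n(K)⊥⊥ contains a
-- Cd-clique of F'_{Cn}; choosing one for every K gives a homomorphism
-- F_n/d → F'_{Cn}/(Cd), because joined vertex sets stay joined after applying a
-- homomorphism and after passing to ⊥⊥. Composing, G → F_n/d yields G → F'_{Cn}/(Cd)
-- with the same ratio n/d. The case C = 0 cannot occur: φ_1 would map a vertex of
-- F_1 into the empty graph F'_0.
module Submission where

open import Defs
open import Data.Nat using (ℕ; zero; suc; _*_; _≤_; _<_; _+_; _≤?_)
open import Data.Nat.Properties
  using (≰⇒>; *-monoʳ-≤; *-assoc; <⇒≤; *-commutativeSemigroup; module ≤-Reasoning)
open import Algebra.Properties.CommutativeSemigroup *-commutativeSemigroup using (x∙yz≈y∙xz)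
open import Data.Fin using (Fin; inject≤)
open import Data.Fin.Properties using (inject≤-injective)
open import Data.Product using (Σ; Σ-syntax; _,_; proj₁; proj₂)
open import Data.Empty using (⊥-elim)
open import Relation.Nullary using (yes; no)
open import Relation.Binary.PropositionalEquality using (_≡_; refl)

module Orthogonality (X : Graph) where

  infix 4 _⊆X_
  _⊆X_ : Subset X → Subset X → Set
  _⊆X_ = _⊆_ {X}

  _⊥X : Subset X → Subset X
  _⊥X = _⊥' {X}

  ⊆-trans : ∀ {S T U} → S ⊆X T → T ⊆X U → S ⊆X U
  ⊆-trans S⊆T T⊆U v v∈S = T⊆U v (S⊆T v v∈S)

  ⊆-⊥⊥ : (S : Subset X) → S ⊆X S ⊥X ⊥X
  ⊆-⊥⊥ S v v∈S s s∈S⊥ = sym X (s∈S⊥ v v∈S)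

  ⊥-antitone : ∀ {S T} → S ⊆X T → T ⊥X ⊆X S ⊥X
  ⊥-antitone S⊆T v v∈T⊥ s s∈S = v∈T⊥ s (S⊆T s s∈S)

  ⊥-swap : ∀ {S T} → S ⊆X T ⊥X → T ⊆X S ⊥X
  ⊥-swap S⊆T⊥ t t∈T s s∈S = sym X (S⊆T⊥ s s∈S t t∈T)

  ⊥⊥-preserves-⊥ : ∀ {S T} → S ⊆X T ⊥X → S ⊥X ⊥X ⊆X (T ⊥X ⊥X) ⊥X
  ⊥⊥-preserves-⊥ {T = T} S⊆T⊥ =
    ⊆-trans (⊥-antitone (⊥-swap S⊆T⊥)) (⊆-⊥⊥ (T ⊥X))

  ⊥⊥-flat : (S : Subset X) → Flat X (S ⊥X ⊥X)
  ⊥⊥-flat S = ⊥-antitone (⊆-⊥⊥ (S ⊥X)) , ⊆-⊥⊥ (S ⊥X ⊥X)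

  HasCliqueIn-mono : ∀ {P Q} m → P ⊆X Q → HasCliqueIn X P m → HasCliqueIn X Q m
  HasCliqueIn-mono m P⊆Q (f , f∈P , clique) = f , (λ i → P⊆Q _ (f∈P i)) , clique

  HasCliqueIn-≤ : ∀ {P m m′} → m′ ≤ m → HasCliqueIn X P m → HasCliqueIn X P m′
  HasCliqueIn-≤ m′≤m (f , f∈P , clique) =
    (λ i → f (inject≤ i m′≤m)) , (λ i → f∈P _) ,
    (λ i j i≢j → clique _ _ (λ eq → i≢j (inject≤-injective m′≤m m′≤m i j eq)))

  Rank-⊥⊥ : ∀ {S r} → Rank X (S ⊥X ⊥X) r → Rank X S r
  Rank-⊥⊥ {S} {r} (clique , noLarger) =
    HasCliqueIn-mono {S ⊥X ⊥X ⊥X ⊥X} r (proj₁ (⊥⊥-flat S)) clique ,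
    λ larger → noLarger (HasCliqueIn-mono {S ⊥X ⊥X} (suc r) (proj₂ (⊥⊥-flat S)) larger)

  clique-≤-Rank : ∀ {S r m} → Rank X S r → HasCliqueIn X S m → m ≤ r
  clique-≤-Rank {S} {r} {m} (_ , noLarger) clique with m ≤? r
  ... | yes m≤r = m≤r
  ... | no m≰r = ⊥-elim (noLarger (HasCliqueIn-≤ {S ⊥X ⊥X} (≰⇒> m≰r) (HasCliqueIn-mono {S} m (⊆-⊥⊥ S) clique)))

Image-⊥ : ∀ {X Y} (f : Hom X Y) {S T : Subset X} →
  _⊆_ {X} S (_⊥' {X} T) →
  _⊆_ {Y} (Image {X} {Y} (map f) S) (_⊥' {Y} (Image {X} {Y} (map f) T))
Image-⊥ f S⊆T⊥ _ (v , v∈S , refl) _ (t , t∈T , refl) = pres f (S⊆T⊥ v v∈S t t∈T)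

LinearLike⇒Rank : ∀ 𝓕 → LinearLike 𝓕 → ∀ n (S : Subset (F 𝓕 n)) → Σ[ r ∈ ℕ ] Rank (F 𝓕 n) S r
LinearLike⇒Rank 𝓕 linear n S with linear n (S ⊥X ⊥X) (⊥⊥-flat S)
  where open Orthogonality (F 𝓕 n)
... | r , closureRank , _ = r , Orthogonality.Rank-⊥⊥ (F 𝓕 n) closureRank

members : {X : Graph} {k : ℕ} → V (X /suc k) → Subset X
members (f , _) v = Σ[ i ∈ Fin _ ] f i ≡ v

members-clique : {X : Graph} {k : ℕ} (K : V (X /suc k)) → HasCliqueIn X (members {X} K) (suc k)
members-clique (f , clique) = f , (λ i → i , refl) , clique

-- suc (k + c * suc k) is suc c * suc k by definition.
/suc-scale : ∀ {X Y} (f : Hom X Y) (c : ℕ) →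
  (∀ S → Σ[ r ∈ ℕ ] Rank X S r) →
  (∀ r S → Rank X S r → RankAtLeast Y (Image {X} {Y} (map f) S) (suc c * r)) →
  ∀ k → Hom (X /suc k) (Y /suc (k + c * suc k))
/suc-scale {X} {Y} f c rank scales k = record { map = scaled ; pres = λ {K} {L} → scaled-pres K L }
  where
  open Orthogonality Y

  image : V (X /suc k) → Subset Y
  image K = Image {X} {Y} (map f) (members {X} K)

  clique : (K : V (X /suc k)) → HasCliqueIn Y (image K ⊥X ⊥X) (suc c * suc k)
  clique K = HasCliqueIn-≤ {image K ⊥X ⊥X} (*-monoʳ-≤ (suc c) d≤r) (scales r (members {X} K) rankK)
    where
    r : ℕ
    r = proj₁ (rank (members {X} K))
    rankK : Rank X (members {X} K) r
    rankK = proj₂ (rank (members {X} K))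
    d≤r : suc k ≤ r
    d≤r = Orthogonality.clique-≤-Rank X rankK (members-clique {X} K)

  scaled : V (X /suc k) → V (Y /suc (k + c * suc k))
  scaled K = proj₁ (clique K) , proj₂ (proj₂ (clique K))

  scaled-pres : ∀ K L → E (X /suc k) K L → E (Y /suc (k + c * suc k)) (scaled K) (scaled L)
  scaled-pres K L K~L i j =
    ⊥⊥-preserves-⊥ (Image-⊥ f members-joined) _ (proj₁ (proj₂ (clique K)) i)
      _ (proj₁ (proj₂ (clique L)) j)
    where
    members-joined : _⊆_ {X} (members {X} K) (_⊥' {X} (members {X} L))
    members-joined _ (i′ , refl) _ (j′ , refl) = K~L i′ j′

_∘Hom_ : ∀ {X Y Z} → Hom Y Z → Hom X Y → Hom X Z
g ∘Hom f = record { map = λ v → map g (map f v) ; pres = λ e → pres g (pres f e) }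

cross-scale : ∀ C {n a b d} → n * b < a * d → C * n * b ≤ a * (C * d)
cross-scale C {n} {a} {b} {d} lt = begin
  C * n * b     ≡⟨ *-assoc C n b ⟩
  C * (n * b)   ≤⟨ *-monoʳ-≤ C (<⇒≤ lt) ⟩
  C * (a * d)   ≡⟨ x∙yz≈y∙xz C a d ⟩
  a * (C * d)   ∎
  where open ≤-Reasoning

proposition4p16 : (𝓕 𝓕' : SemiringFamily) → LinearLike 𝓕 → LinearLike 𝓕' →
    (C : ℕ) → (φ : ∀ n → Hom (F 𝓕 n) (F 𝓕' (C * n))) →
    (∀ n r (S : Subset (F 𝓕 n)) → Rank (F 𝓕 n) S r →
    RankAtLeast (F 𝓕' (C * n)) (Image {F 𝓕 n} {F 𝓕' (C * n)} (map (φ n)) S) (C * r)) →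
    (G : Graph) → Finite G → EtaLE 𝓕' 𝓕 G
proposition4p16 𝓕 𝓕' _ _ zero φ _ _ _ _ _ _ _ _ _ =
  ⊥-elim (empty0 𝓕' (map (φ 1) (inhab1 𝓕)))
proposition4p16 𝓕 𝓕' linear _ (suc c) φ scales _ _ n k G→F/d a b lt =
  suc c * n , k + c * suc k ,
  /suc-scale (φ n) c (LinearLike⇒Rank 𝓕 linear n) (scales n) k ∘Hom G→F/d ,
  cross-scale (suc c) {n} {a} {suc b} {suc k} lt
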